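{- Let $k\geq 1$, $n=8k+r$ with $r\in\{2,5\}$, $G=C(n,\pm\{1,2,3,4\})$, and $a\in\mathbb{Z}_n$. If $X\subseteq V(G)$ resolves $A=\{a,a+1,a+2,a+5,a+6,a+7\}$ (indices mod $n$), then $|X|\geq 3$.
   Context: $C(n,\pm\{1,2,3,4\})$ is the graph on $\mathbb{Z}_n$ where distinct $i,j$ are adjacent iff $j-i\equiv\pm s\pmod n$ for some $s\in\{1,2,3,4\}$; $d$ is graph distance, and $r(v|X)=(d(v,x))_{x\in X}$. A set $X$ resolves a set $A$ if $r(a|X)\neq r(b|X)$ for all distinct $a,b\in A$. -}

module Defs where

open import Data.Nat using (ℕ; zero; suc; _+_; _<_)
open import Data.Nat.DivMod using (_%_; m%n<n)
open import Data.Fin using (Fin; toℕ; fromℕ<)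
open import Data.Fin.Subset using (Subset; _∈_)
open import Data.List using (List)
open import Data.List.Membership.Propositional using () renaming (_∈_ to _∈ₗ_)
open import Data.Product using (Σ; ∃; _×_)
open import Data.Sum using (_⊎_)
open import Relation.Binary.PropositionalEquality using (_≡_; _≢_)
open import Relation.Nullary using (¬_)

data Conn : ℕ → Set where
  s1 : Conn 1
  s2 : Conn 2
  s3 : Conn 3
  s4 : Conn 4

-- j - i ≡ s (mod n) for vertices i j of ℤ_n (represented by 0..n-1) and 0 < s < n
-- unfolds to: j = i + s or j + n = i + s.
DiffIs : ∀ {n} → Fin n → Fin n → ℕ → Set
DiffIs {n} i j s = (toℕ i + s ≡ toℕ j) ⊎ (toℕ i + s ≡ toℕ j + n)

Adj : ∀ {n} → Fin n → Fin n → Set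
Adj i j = (i ≢ j) × (∃ λ s → Conn s × (DiffIs i j s ⊎ DiffIs j i s))

data Walk {n : ℕ} : ℕ → Fin n → Fin n → Set where
  here : ∀ {i} → Walk zero i i
  step : ∀ {m i l j} → Walk m i l → Adj l j → Walk (suc m) i j

IsDist : ∀ {n} → Fin n → Fin n → ℕ → Set
IsDist i j m = Walk m i j × (∀ m' → m' < m → ¬ Walk m' i j)

_⊕_ : ∀ {n} → Fin n → ℕ → Fin n
_⊕_ {suc m} i t = fromℕ< (m%n<n (toℕ i + t) (suc m))

Resolves : ∀ {n} → Subset n → List (Fin n) → Set
Resolves {n} X A =
  ∀ a b → a ∈ₗ A → b ∈ₗ A → a ≢ b →
  Σ (Fin n) λ x → x ∈ X × (∃ λ da → ∃ λ db → IsDist a x da × IsDist b x db × da ≢ db)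

module Submission where

-- In C(n, ±{1,2,3,4}) two vertices whose positions differ by δ are ⌈min(δ, n − δ)/4⌉ apart:
-- steps of length 4 realise this, and a walk of k steps moves at most 4k around the cycle.
-- So the distances from A = a + {0,1,2,5,6,7} to a landmark a + t depend only on n and t
-- (the profile of t). For any two offsets t₁, t₂ some two vertices of A have equal profiles
-- at both, hence no two landmarks resolve A. This is checked exhaustively for
-- n = 10, 13, 18, 21, 26, 29; from n to n + 8 (n ≥ 22) every profile of the larger cycle is a
-- profile of the smaller one plus a constant, which carries the property to all n = 8k + r.


open import Defs
open import Data.Nat as ℕ
  using (ℕ; zero; suc; _+_; _*_; _∸_; _⊓_; ∣_-_∣; _≤_; _<_; _≥_; z≤n; s≤s; _≤?_; _<?_)
open import Data.Nat.Properties
open import Data.Nat.DivMod using (_%_; _/_; m≡m%n+[m/n]*n; m<n⇒m%n≡m; [m+kn]%n≡m%n; [m+n]%n≡m%n; %-distribˡ-+; m%n%n≡m%n)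
open import Data.Nat.Tactic.RingSolver using (solve-∀)
open import Data.Integer as ℤ using (ℤ)
import Data.Integer.Properties as ℤ
import Data.Integer.Tactic.RingSolver as ℤ-Solver
open import Data.Fin as Fin using (Fin; toℕ; fromℕ<)
open import Data.Fin.Properties using (toℕ-fromℕ<; toℕ-injective; toℕ<n; all?; any?)
open import Data.Fin.Subset using (Subset; ∣_∣; inside; outside; _∈_)
open import Data.Vec.Base using ([]; _∷_; here; there)
open import Data.List using (List; []; _∷_; length; map; lookup)
open import Data.List.Properties using (length-map)
open import Data.List.Membership.Propositional using () renaming (_∈_ to _∈ₗ_)
open import Data.List.Membership.Propositional.Properties using (∈-map⁺; ∈-lookup)
open import Data.List.Relation.Unary.Any using (here; there)
open import Data.Product using (Σ-syntax; _×_; _,_)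
open import Data.Sum using (_⊎_; inj₁; inj₂)
open import Data.Empty using (⊥-elim)
open import Relation.Nullary using (¬_; contradiction; yes; no)
open import Relation.Nullary.Decidable using (True; toWitness; _×-dec_)
open import Relation.Binary.PropositionalEquality

⌈_/4⌉ : ℕ → ℕ
⌈ 0 /4⌉ = 0
⌈ 1 /4⌉ = 1
⌈ 2 /4⌉ = 1
⌈ 3 /4⌉ = 1
⌈ 4 /4⌉ = 1
⌈ suc (suc (suc (suc (suc c)))) /4⌉ = suc ⌈ suc c /4⌉

⌈4+c/4⌉≡1+⌈c/4⌉ : ∀ c → ⌈ 4 + c /4⌉ ≡ suc ⌈ c /4⌉
⌈4+c/4⌉≡1+⌈c/4⌉ zero    = refl
⌈4+c/4⌉≡1+⌈c/4⌉ (suc c) = refl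

c≤k*4⇒⌈c/4⌉≤k : ∀ c k → c ≤ k * 4 → ⌈ c /4⌉ ≤ k
c≤k*4⇒⌈c/4⌉≤k zero                          k       _ = z≤n
c≤k*4⇒⌈c/4⌉≤k 1                             (suc k) _ = s≤s z≤n
c≤k*4⇒⌈c/4⌉≤k 2                             (suc k) _ = s≤s z≤n
c≤k*4⇒⌈c/4⌉≤k 3                             (suc k) _ = s≤s z≤n
c≤k*4⇒⌈c/4⌉≤k 4                             (suc k) _ = s≤s z≤n
c≤k*4⇒⌈c/4⌉≤k (suc (suc (suc (suc (suc c))))) (suc k) (s≤s (s≤s (s≤s (s≤s c≤k*4)))) =
  s≤s (c≤k*4⇒⌈c/4⌉≤k (suc c) k c≤k*4)

arc : ℕ → ℕ → ℕ
arc n δ = δ ⊓ (n ∸ δ)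

arc+arc≤n : ∀ {n δ} → δ ≤ n → arc n δ + arc n δ ≤ n
arc+arc≤n {n} {δ} δ≤n = begin
  arc n δ + arc n δ  ≤⟨ +-mono-≤ (m⊓n≤m δ (n ∸ δ)) (m⊓n≤n δ (n ∸ δ)) ⟩
  δ + (n ∸ δ)        ≡⟨ m+[n∸m]≡n δ≤n ⟩
  n                  ∎
  where open ≤-Reasoning

arc-short : ∀ {n δ} → δ + δ ≤ n → arc n δ ≡ δ
arc-short {δ = δ} δ+δ≤n = m≤n⇒m⊓n≡m (m+n≤o⇒m≤o∸n δ δ+δ≤n)

arc-long : ∀ {n δ} → n ≤ δ + δ → arc n δ ≡ n ∸ δ
arc-long {n} {δ} n≤δ+δ = m≥n⇒m⊓n≡n (m≤n+o⇒m∸n≤o n δ n≤δ+δ)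

arc-stretch : ∀ {n δ} → δ ≤ n → arc (8 + n) (4 + δ) ≡ 4 + arc n δ
arc-stretch {n} {δ} δ≤n = begin
  (4 + δ) ⊓ ((4 + n) ∸ δ)  ≡⟨ cong ((4 + δ) ⊓_) (+-∸-assoc 4 δ≤n) ⟩
  (4 + δ) ⊓ (4 + (n ∸ δ))  ≡⟨ +-distribˡ-⊓ 4 δ (n ∸ δ) ⟨
  4 + arc n δ              ∎
  where open ≡-Reasoning

displacement : ∀ {a b c d} (z : ℤ) n → a + b ≡ c + d * n →
  ℤ.+ c ℤ.- ℤ.+ a ℤ.- z ℤ.* ℤ.+ n ≡ ℤ.+ b ℤ.- (ℤ.+ d ℤ.+ z) ℤ.* ℤ.+ n
displacement {a} {b} {c} {d} z n a+b≡c+dn = begin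
  C ℤ.- A ℤ.- z ℤ.* N                    ≡⟨ move C A D z N ⟩
  (C ℤ.+ D ℤ.* N) ℤ.- A ℤ.- (D ℤ.+ z) ℤ.* N ≡⟨ cong (λ u → u ℤ.- A ℤ.- (D ℤ.+ z) ℤ.* N) in-ℤ ⟨
  (A ℤ.+ B) ℤ.- A ℤ.- (D ℤ.+ z) ℤ.* N     ≡⟨ cancel A B D z N ⟩
  B ℤ.- (D ℤ.+ z) ℤ.* N                  ∎
  where
  open ≡-Reasoning
  A = ℤ.+ a ; B = ℤ.+ b ; C = ℤ.+ c ; D = ℤ.+ d ; N = ℤ.+ n
  in-ℤ : A ℤ.+ B ≡ C ℤ.+ D ℤ.* N
  in-ℤ = trans (sym (ℤ.pos-+ a b)) (trans (cong ℤ.+_ a+b≡c+dn) (trans (ℤ.pos-+ c (d * n)) (cong (λ u → C ℤ.+ u) (ℤ.pos-* d n))))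
  move : ∀ C A D z N → C ℤ.- A ℤ.- z ℤ.* N ≡ (C ℤ.+ D ℤ.* N) ℤ.- A ℤ.- (D ℤ.+ z) ℤ.* N
  move = ℤ-Solver.solve-∀
  cancel : ∀ A B D z N → (A ℤ.+ B) ℤ.- A ℤ.- (D ℤ.+ z) ℤ.* N ≡ B ℤ.- (D ℤ.+ z) ℤ.* N
  cancel = ℤ-Solver.solve-∀

n≤∣w*n∣⇒c≤∣c-w*n∣ : ∀ {c n} w → c + c ≤ n → n ≤ ℤ.∣ w ℤ.* ℤ.+ n ∣ → c ≤ ℤ.∣ ℤ.+ c ℤ.- w ℤ.* ℤ.+ n ∣
n≤∣w*n∣⇒c≤∣c-w*n∣ {c} {n} w c+c≤n n≤∣wn∣ = +-cancelˡ-≤ c c _ (≤-trans c+c≤n (begin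
  n                                        ≤⟨ n≤∣wn∣ ⟩
  ℤ.∣ w ℤ.* ℤ.+ n ∣                        ≡⟨ cong ℤ.∣_∣ (swap (ℤ.+ c) w (ℤ.+ n)) ⟩
  ℤ.∣ ℤ.+ c ℤ.- (ℤ.+ c ℤ.- w ℤ.* ℤ.+ n) ∣  ≤⟨ ℤ.∣i-j∣≤∣i∣+∣j∣ (ℤ.+ c) (ℤ.+ c ℤ.- w ℤ.* ℤ.+ n) ⟩
  c + ℤ.∣ ℤ.+ c ℤ.- w ℤ.* ℤ.+ n ∣          ∎))
  where
  open ≤-Reasoning
  swap : ∀ c w n → w ℤ.* n ≡ c ℤ.- (c ℤ.- w ℤ.* n)
  swap = ℤ-Solver.solve-∀

-- Every point of c + nℤ other than c itself lies at least n - c ≥ c away from 0.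
c≤∣c-w*n∣ : ∀ {c n} w → c + c ≤ n → c ≤ ℤ.∣ ℤ.+ c ℤ.- w ℤ.* ℤ.+ n ∣
c≤∣c-w*n∣ {c} (ℤ.+ zero) _     = m≤m+n c 0
c≤∣c-w*n∣ {n = n} w@(ℤ.+[1+ k ]) c+c≤n =
  n≤∣w*n∣⇒c≤∣c-w*n∣ w c+c≤n (≤-trans (m≤n*m n (suc k)) (≤-reflexive (sym (ℤ.∣i*j∣≡∣i∣*∣j∣ w (ℤ.+ n)))))
c≤∣c-w*n∣ {n = n} w@(ℤ.-[1+ k ]) c+c≤n =
  n≤∣w*n∣⇒c≤∣c-w*n∣ w c+c≤n (≤-trans (m≤n*m n (suc k)) (≤-reflexive (sym (ℤ.∣i*j∣≡∣i∣*∣j∣ w (ℤ.+ n)))))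

module Circulant (m : ℕ) (4≤m : 4 ≤ m) where

  n : ℕ
  n = suc m

  toℕ-⊕ : ∀ (p : Fin n) c → toℕ (p ⊕ c) ≡ (toℕ p + c) % n
  toℕ-⊕ p c = toℕ-fromℕ< _

  ⊕-≡ : ∀ {x} (p : Fin n) c k → toℕ p + c ≡ toℕ x + k * n → p ⊕ c ≡ x
  ⊕-≡ {x} p c k p+c≡x+kn = toℕ-injective (begin
    toℕ (p ⊕ c)         ≡⟨ toℕ-⊕ p c ⟩
    (toℕ p + c) % n     ≡⟨ cong (_% n) p+c≡x+kn ⟩
    (toℕ x + k * n) % n ≡⟨ [m+kn]%n≡m%n (toℕ x) k n ⟩
    toℕ x % n           ≡⟨ m<n⇒m%n≡m (toℕ<n x) ⟩
    toℕ x               ∎)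
    where open ≡-Reasoning

  ⊕-identityʳ : ∀ (p : Fin n) → p ⊕ 0 ≡ p
  ⊕-identityʳ p = ⊕-≡ p 0 0 refl

  ⊕-n : ∀ (p : Fin n) → p ⊕ n ≡ p
  ⊕-n p = ⊕-≡ p n 1 (cong (toℕ p +_) (sym (+-identityʳ n)))

  ⊕-assoc : ∀ (p : Fin n) b c → (p ⊕ b) ⊕ c ≡ p ⊕ (b + c)
  ⊕-assoc p b c = toℕ-injective (begin
    toℕ ((p ⊕ b) ⊕ c)             ≡⟨ toℕ-⊕ (p ⊕ b) c ⟩
    (toℕ (p ⊕ b) + c) % n         ≡⟨ cong (λ v → (v + c) % n) (toℕ-⊕ p b) ⟩
    ((toℕ p + b) % n + c) % n     ≡⟨ %-distribˡ-+ ((toℕ p + b) % n) c n ⟩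
    ((toℕ p + b) % n % n + c % n) % n ≡⟨ cong (λ v → (v + c % n) % n) (m%n%n≡m%n (toℕ p + b) n) ⟩
    ((toℕ p + b) % n + c % n) % n ≡⟨ %-distribˡ-+ (toℕ p + b) c n ⟨
    (toℕ p + b + c) % n           ≡⟨ cong (_% n) (+-assoc (toℕ p) b c) ⟩
    (toℕ p + (b + c)) % n         ≡⟨ toℕ-⊕ p (b + c) ⟨
    toℕ (p ⊕ (b + c))             ∎)
    where open ≡-Reasoning

  ⊕-diff : ∀ (p : Fin n) {c} → c < n → DiffIs p (p ⊕ c) c
  ⊕-diff p {c} c<n with toℕ p + c <? n
  ... | yes p+c<n = inj₁ (sym (trans (toℕ-⊕ p c) (m<n⇒m%n≡m p+c<n)))
  ... | no p+c≮n = inj₂ (begin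
    toℕ p + c                 ≡⟨ m∸n+n≡m (≮⇒≥ p+c≮n) ⟨
    (toℕ p + c ∸ n) + n       ≡⟨ cong (_+ n) (sym (trans (toℕ-⊕ p c) wrapped)) ⟩
    toℕ (p ⊕ c) + n           ∎)
    where
    open ≡-Reasoning
    wrapped : (toℕ p + c) % n ≡ toℕ p + c ∸ n
    wrapped = begin
      (toℕ p + c) % n           ≡⟨ cong (_% n) (m∸n+n≡m (≮⇒≥ p+c≮n)) ⟨
      (toℕ p + c ∸ n + n) % n   ≡⟨ [m+n]%n≡m%n (toℕ p + c ∸ n) n ⟩
      (toℕ p + c ∸ n) % n       ≡⟨ m<n⇒m%n≡m (m<n+o⇒m∸n<o (toℕ p + c) n (+-mono-< (toℕ<n p) c<n)) ⟩
      toℕ p + c ∸ n             ∎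

  p≢p⊕c : ∀ (p : Fin n) {c} → 0 < c → c < n → p ≢ p ⊕ c
  p≢p⊕c p {c} 0<c c<n p≡p⊕c with ⊕-diff p c<n
  ... | inj₁ p+c≡p = >⇒≢ 0<c (+-cancelˡ-≡ (toℕ p) c 0 (trans p+c≡p (trans (cong toℕ (sym p≡p⊕c)) (sym (+-identityʳ (toℕ p))))))
  ... | inj₂ p+c≡p+n = <⇒≢ c<n (+-cancelˡ-≡ (toℕ p) c n (trans p+c≡p+n (cong (λ v → toℕ v + n) (sym p≡p⊕c))))

  conn≤4 : ∀ {s} → Conn s → s ≤ 4
  conn≤4 s1 = s≤s z≤n
  conn≤4 s2 = s≤s (s≤s z≤n)
  conn≤4 s3 = s≤s (s≤s (s≤s z≤n))
  conn≤4 s4 = ≤-refl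

  0<conn : ∀ {s} → Conn s → 0 < s
  0<conn s1 = s≤s z≤n
  0<conn s2 = s≤s z≤n
  0<conn s3 = s≤s z≤n
  0<conn s4 = s≤s z≤n

  adj-⊕ : ∀ (p : Fin n) {s} → Conn s → Adj p (p ⊕ s)
  adj-⊕ p {s} conn = p≢p⊕c p (0<conn conn) s<n , s , conn , inj₁ (⊕-diff p s<n)
    where
    s<n : s < n
    s<n = s≤s (≤-trans (conn≤4 conn) 4≤m)

  adj-sym : ∀ {p x : Fin n} → Adj p x → Adj x p
  adj-sym (p≢x , s , conn , inj₁ diff) = ≢-sym p≢x , s , conn , inj₂ diff
  adj-sym (p≢x , s , conn , inj₂ diff) = ≢-sym p≢x , s , conn , inj₁ diff

  walk-cons : ∀ {k} {p l x : Fin n} → Adj p l → Walk k l x → Walk (suc k) p x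
  walk-cons p~l here         = step here p~l
  walk-cons p~l (step w k~x) = step (walk-cons p~l w) k~x

  walk-reverse : ∀ {k} {p x : Fin n} → Walk k p x → Walk k x p
  walk-reverse here         = here
  walk-reverse (step w l~x) = walk-cons (adj-sym l~x) (walk-reverse w)

  walk-⊕ : ∀ c (p : Fin n) → Walk ⌈ c /4⌉ p (p ⊕ c)
  walk-⊕ 0 p = subst (Walk 0 p) (sym (⊕-identityʳ p)) here
  walk-⊕ 1 p = step here (adj-⊕ p s1)
  walk-⊕ 2 p = step here (adj-⊕ p s2)
  walk-⊕ 3 p = step here (adj-⊕ p s3)
  walk-⊕ 4 p = step here (adj-⊕ p s4)
  walk-⊕ (suc (suc (suc (suc (suc c))))) p =
    subst (Walk _ p) (trans (⊕-assoc p (suc c) 4) (cong (p ⊕_) (+-comm (suc c) 4)))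
      (step (walk-⊕ (suc c) p) (adj-⊕ (p ⊕ suc c) s4))

  record Near (p x : Fin n) (e : ℕ) : Set where
    constructor near
    field
      winding : ℤ
      within  : ℤ.∣ ℤ.+ toℕ x ℤ.- ℤ.+ toℕ p ℤ.- winding ℤ.* ℤ.+ n ∣ ≤ e

  near-refl : ∀ (p : Fin n) → Near p p 0
  near-refl p = near ℤ.0ℤ (≤-reflexive (cong ℤ.∣_∣ (cancel (ℤ.+ toℕ p) (ℤ.+ n))))
    where
    cancel : ∀ p n → p ℤ.- p ℤ.- ℤ.0ℤ ℤ.* n ≡ ℤ.0ℤ
    cancel = ℤ-Solver.solve-∀

  near-mono : ∀ {p x : Fin n} {e e′} → e ≤ e′ → Near p x e → Near p x e′
  near-mono e≤e′ (near z within) = near z (≤-trans within e≤e′)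

  near-sym : ∀ {p x : Fin n} {e} → Near p x e → Near x p e
  near-sym {p} {x} {e} (near z within) = near (ℤ.- z) (subst (_≤ e) ∣x-p-zn∣≡∣p-x+zn∣ within)
    where
    X = ℤ.+ toℕ x ; P = ℤ.+ toℕ p ; N = ℤ.+ n
    negate : ∀ x p z n → ℤ.- (x ℤ.- p ℤ.- z ℤ.* n) ≡ p ℤ.- x ℤ.- (ℤ.- z) ℤ.* n
    negate = ℤ-Solver.solve-∀
    ∣x-p-zn∣≡∣p-x+zn∣ : ℤ.∣ X ℤ.- P ℤ.- z ℤ.* N ∣ ≡ ℤ.∣ P ℤ.- X ℤ.- (ℤ.- z) ℤ.* N ∣
    ∣x-p-zn∣≡∣p-x+zn∣ = trans (sym (ℤ.∣-i∣≡∣i∣ (X ℤ.- P ℤ.- z ℤ.* N))) (cong ℤ.∣_∣ (negate X P z N))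

  near-trans : ∀ {p l x : Fin n} {e₁ e₂} → Near p l e₁ → Near l x e₂ → Near p x (e₂ + e₁)
  near-trans {p} {l} {x} {e₁} {e₂} (near z₁ within₁) (near z₂ within₂) = near (z₁ ℤ.+ z₂) (begin
    ℤ.∣ X ℤ.- P ℤ.- (z₁ ℤ.+ z₂) ℤ.* N ∣                         ≡⟨ cong ℤ.∣_∣ (split X L P z₁ z₂ N) ⟩
    ℤ.∣ (X ℤ.- L ℤ.- z₂ ℤ.* N) ℤ.+ (L ℤ.- P ℤ.- z₁ ℤ.* N) ∣     ≤⟨ ℤ.∣i+j∣≤∣i∣+∣j∣ (X ℤ.- L ℤ.- z₂ ℤ.* N) _ ⟩
    ℤ.∣ X ℤ.- L ℤ.- z₂ ℤ.* N ∣ + ℤ.∣ L ℤ.- P ℤ.- z₁ ℤ.* N ∣     ≤⟨ +-mono-≤ within₂ within₁ ⟩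
    e₂ + e₁                                                    ∎)
    where
    open ≤-Reasoning
    X = ℤ.+ toℕ x ; L = ℤ.+ toℕ l ; P = ℤ.+ toℕ p ; N = ℤ.+ n
    split : ∀ x l p z₁ z₂ n → x ℤ.- p ℤ.- (z₁ ℤ.+ z₂) ℤ.* n ≡ (x ℤ.- l ℤ.- z₂ ℤ.* n) ℤ.+ (l ℤ.- p ℤ.- z₁ ℤ.* n)
    split = ℤ-Solver.solve-∀

  near-lift : ∀ {p x : Fin n} {s} k → toℕ p + s ≡ toℕ x + k * n → Near p x s
  near-lift {s = s} k p+s≡x+kn =
    near (ℤ.- ℤ.+ k) (≤-reflexive (cong ℤ.∣_∣ (trans (displacement (ℤ.- ℤ.+ k) n p+s≡x+kn) (cancel (ℤ.+ s) (ℤ.+ k) (ℤ.+ n)))))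
    where
    cancel : ∀ s k n → s ℤ.- (k ℤ.+ ℤ.- k) ℤ.* n ≡ s
    cancel = ℤ-Solver.solve-∀

  near-diff : ∀ {p x : Fin n} {s} → DiffIs p x s → Near p x s
  near-diff {x = x} (inj₁ p+s≡x)   = near-lift 0 (trans p+s≡x (sym (+-identityʳ (toℕ x))))
  near-diff {x = x} (inj₂ p+s≡x+n) = near-lift 1 (trans p+s≡x+n (cong (toℕ x +_) (sym (+-identityʳ n))))

  near-adj : ∀ {p x : Fin n} → Adj p x → Near p x 4
  near-adj (_ , _ , conn , inj₁ diff) = near-mono (conn≤4 conn) (near-diff diff)
  near-adj (_ , _ , conn , inj₂ diff) = near-mono (conn≤4 conn) (near-sym (near-diff diff))

  near-walk : ∀ {k} {p x : Fin n} → Walk k p x → Near p x (k * 4)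
  near-walk {p = p} here = near-refl p
  near-walk (step w l~x) = near-trans (near-walk w) (near-adj l~x)

  near-⊕ : ∀ (p : Fin n) {c e} → c + c ≤ n → Near p (p ⊕ c) e → c ≤ e
  near-⊕ p {c} {e} c+c≤n (near z within) = ≤-trans (c≤∣c-w*n∣ (ℤ.+ ((toℕ p + c) / n) ℤ.+ z) c+c≤n)
    (subst (_≤ e) (cong ℤ.∣_∣ (displacement z n p+c≡⊕+qn)) within)
    where
    p+c≡⊕+qn : toℕ p + c ≡ toℕ (p ⊕ c) + ((toℕ p + c) / n) * n
    p+c≡⊕+qn = trans (m≡m%n+[m/n]*n (toℕ p + c) n) (cong (_+ ((toℕ p + c) / n) * n) (sym (toℕ-⊕ p c)))

  Apart : Fin n → Fin n → ℕ → Set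
  Apart p x c = x ≡ p ⊕ c ⊎ p ≡ x ⊕ c

  apart-sym : ∀ {p x : Fin n} {c} → Apart p x c → Apart x p c
  apart-sym (inj₁ x≡p⊕c) = inj₂ x≡p⊕c
  apart-sym (inj₂ p≡x⊕c) = inj₁ p≡x⊕c

  walk-apart : ∀ {p x : Fin n} {c} → Apart p x c → Walk ⌈ c /4⌉ p x
  walk-apart {p} {c = c} (inj₁ refl) = walk-⊕ c p
  walk-apart {x = x} {c} (inj₂ refl) = walk-reverse (walk-⊕ c x)

  apart-walk : ∀ {k} {p x : Fin n} {c} → Apart p x c → c + c ≤ n → Walk k p x → c ≤ k * 4
  apart-walk {p = p} (inj₁ refl) c+c≤n w = near-⊕ p c+c≤n (near-walk w)
  apart-walk {x = x} (inj₂ refl) c+c≤n w = near-⊕ x c+c≤n (near-walk (walk-reverse w))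

  dist-apart : ∀ {p x : Fin n} {c d} → Apart p x c → c + c ≤ n → IsDist p x d → d ≡ ⌈ c /4⌉
  dist-apart {c = c} {d} apart c+c≤n (w , minimal) = ≤-antisym
    (≮⇒≥ λ ⌈c/4⌉<d → minimal ⌈ c /4⌉ ⌈c/4⌉<d (walk-apart apart))
    (c≤k*4⇒⌈c/4⌉≤k c d (apart-walk apart c+c≤n w))

  apart-⊕ : ∀ (p : Fin n) {δ} → δ ≤ n → Apart p (p ⊕ δ) (arc n δ)
  apart-⊕ p {δ} δ≤n with ⊓-sel δ (n ∸ δ)
  ... | inj₁ arc≡δ   = inj₁ (cong (p ⊕_) (sym arc≡δ))
  ... | inj₂ arc≡n∸δ = inj₂ (begin
    p                           ≡⟨ ⊕-n p ⟨
    p ⊕ n                       ≡⟨ cong (p ⊕_) (m+[n∸m]≡n δ≤n) ⟨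
    p ⊕ (δ + (n ∸ δ))           ≡⟨ ⊕-assoc p δ (n ∸ δ) ⟨
    (p ⊕ δ) ⊕ (n ∸ δ)           ≡⟨ cong ((p ⊕ δ) ⊕_) arc≡n∸δ ⟨
    (p ⊕ δ) ⊕ arc n δ           ∎)
    where open ≡-Reasoning

  apart-offsets : ∀ (a : Fin n) {o t} → o < n → t < n → Apart (a ⊕ o) (a ⊕ t) (arc n ∣ t - o ∣)
  apart-offsets a {o} {t} o<n t<n with ≤-total o t
  ... | inj₁ o≤t = subst₂ (Apart (a ⊕ o)) a⊕o⊕δ≡a⊕t (cong (arc n) (sym (m≤n⇒∣n-m∣≡n∸m o≤t)))
                     (apart-⊕ (a ⊕ o) (≤-trans (m∸n≤m t o) (<⇒≤ t<n)))
    where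
    a⊕o⊕δ≡a⊕t : (a ⊕ o) ⊕ (t ∸ o) ≡ a ⊕ t
    a⊕o⊕δ≡a⊕t = trans (⊕-assoc a o (t ∸ o)) (cong (a ⊕_) (m+[n∸m]≡n o≤t))
  ... | inj₂ t≤o = subst₂ (λ p → Apart p (a ⊕ t)) a⊕t⊕δ≡a⊕o (cong (arc n) (sym (m≤n⇒∣m-n∣≡n∸m t≤o)))
                     (apart-sym (apart-⊕ (a ⊕ t) (≤-trans (m∸n≤m o t) (<⇒≤ o<n))))
    where
    a⊕t⊕δ≡a⊕o : (a ⊕ t) ⊕ (o ∸ t) ≡ a ⊕ o
    a⊕t⊕δ≡a⊕o = trans (⊕-assoc a t (o ∸ t)) (cong (a ⊕_) (m+[n∸m]≡n t≤o))

offsets : List ℕ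
offsets = 0 ∷ 1 ∷ 2 ∷ 5 ∷ 6 ∷ 7 ∷ []

offset : Fin 6 → ℕ
offset = lookup offsets

offset≤7 : ∀ i → offset i ≤ 7
offset≤7 = toWitness {a? = all? λ i → offset i ≤? 7} _

-- The distance from a ⊕ offset i to a ⊕ t in C(n, ±{1,2,3,4}) (see dist-profile).
profile : ℕ → ℕ → Fin 6 → ℕ
profile n t i = ⌈ arc n ∣ t - offset i ∣ /4⌉

Confusable : ℕ → ℕ → ℕ → Set
Confusable n t₁ t₂ = Σ[ i ∈ Fin 6 ] Σ[ j ∈ Fin 6 ]
  offset i < offset j × profile n t₁ i ≡ profile n t₁ j × profile n t₂ i ≡ profile n t₂ j

AllConfusable : ℕ → Set
AllConfusable n = ∀ {t₁ t₂} → t₁ < n → t₂ < n → Confusable n t₁ t₂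

allConfusable-by-computation :
  ∀ n → True (all? λ (t₁ : Fin n) → all? λ (t₂ : Fin n) → any? λ i → any? λ j →
          offset i <? offset j ×-dec profile n (toℕ t₁) i ≟ profile n (toℕ t₁) j
                               ×-dec profile n (toℕ t₂) i ≟ profile n (toℕ t₂) j) →
  AllConfusable n
allConfusable-by-computation n check t₁<n t₂<n =
  subst₂ (Confusable n) (toℕ-fromℕ< t₁<n) (toℕ-fromℕ< t₂<n) (toWitness check (fromℕ< t₁<n) (fromℕ< t₂<n))

profile-near : ∀ {n t} → 22 ≤ n → t ≤ 10 → ∀ i → profile (8 + n) t i ≡ profile n t i
profile-near {n} {t} 22≤n t≤10 i = cong ⌈_/4⌉ (trans (arc-short (≤-trans short (m≤n+m n 8))) (sym (arc-short short)))
  where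
  δ≤10 : ∣ t - offset i ∣ ≤ 10
  δ≤10 = ≤-trans (∣m-n∣≤m⊔n t (offset i)) (⊔-lub t≤10 (≤-trans (offset≤7 i) (m≤m+n 7 3)))
  short : ∣ t - offset i ∣ + ∣ t - offset i ∣ ≤ n
  short = ≤-trans (+-mono-≤ δ≤10 δ≤10) (≤-trans (m≤m+n 20 2) 22≤n)

profile-middle : ∀ {n t} → 7 ≤ t → t ≤ n → ∀ i → profile (8 + n) (4 + t) i ≡ suc (profile n t i)
profile-middle {n} {t} 7≤t t≤n i = begin
  ⌈ arc (8 + n) ∣ 4 + t - o ∣ /4⌉  ≡⟨ cong (λ δ → ⌈ arc (8 + n) δ /4⌉) ∣4+t-o∣≡4+∣t-o∣ ⟩
  ⌈ arc (8 + n) (4 + ∣ t - o ∣) /4⌉ ≡⟨ cong ⌈_/4⌉ (arc-stretch ∣t-o∣≤n) ⟩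
  ⌈ 4 + arc n ∣ t - o ∣ /4⌉        ≡⟨ ⌈4+c/4⌉≡1+⌈c/4⌉ (arc n ∣ t - o ∣) ⟩
  suc ⌈ arc n ∣ t - o ∣ /4⌉        ∎
  where
  open ≡-Reasoning
  o = offset i
  o≤t : o ≤ t
  o≤t = ≤-trans (offset≤7 i) 7≤t
  ∣4+t-o∣≡4+∣t-o∣ : ∣ 4 + t - o ∣ ≡ 4 + ∣ t - o ∣
  ∣4+t-o∣≡4+∣t-o∣ = begin
    ∣ 4 + t - o ∣  ≡⟨ m≤n⇒∣n-m∣≡n∸m (≤-trans o≤t (m≤n+m t 4)) ⟩
    4 + t ∸ o      ≡⟨ +-∸-assoc 4 o≤t ⟩
    4 + (t ∸ o)    ≡⟨ cong (4 +_) (m≤n⇒∣n-m∣≡n∸m o≤t) ⟨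
    4 + ∣ t - o ∣  ∎
  ∣t-o∣≤n : ∣ t - o ∣ ≤ n
  ∣t-o∣≤n = ≤-trans (≤-reflexive (m≤n⇒∣n-m∣≡n∸m o≤t)) (≤-trans (m∸n≤m t o) t≤n)

profile-behind : ∀ {n t} → 22 ≤ n → n ≤ 4 + t → ∀ i → profile (8 + n) (8 + t) i ≡ profile n t i
profile-behind {n} {t} 22≤n n≤4+t i = cong ⌈_/4⌉ arcs-agree
  where
  o = offset i
  δ = t ∸ o
  o≤t : o ≤ t
  o≤t = ≤-trans (offset≤7 i) (+-cancelˡ-≤ 4 7 t (≤-trans (m≤m+n 11 11) (≤-trans 22≤n n≤4+t)))
  n≤11+δ : n ≤ 11 + δ
  n≤11+δ = begin
    n            ≤⟨ n≤4+t ⟩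
    4 + t        ≡⟨ cong (4 +_) (m∸n+n≡m o≤t) ⟨
    4 + (δ + o)  ≤⟨ +-monoʳ-≤ 4 (+-monoʳ-≤ δ (offset≤7 i)) ⟩
    4 + (δ + 7)  ≡⟨ cong (4 +_) (+-comm δ 7) ⟩
    11 + δ       ∎
    where open ≤-Reasoning
  ∣8+t-o∣≡8+δ : ∣ 8 + t - o ∣ ≡ 8 + δ
  ∣8+t-o∣≡8+δ = trans (m≤n⇒∣n-m∣≡n∸m (≤-trans o≤t (m≤n+m t 8))) (+-∸-assoc 8 o≤t)
  n≤δ+δ : n ≤ δ + δ
  n≤δ+δ = ≤-trans n≤11+δ (+-monoˡ-≤ δ (+-cancelˡ-≤ 11 11 δ (≤-trans 22≤n n≤11+δ)))
  arcs-agree : arc (8 + n) ∣ 8 + t - o ∣ ≡ arc n ∣ t - o ∣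
  arcs-agree = begin
    arc (8 + n) ∣ 8 + t - o ∣  ≡⟨ cong (arc (8 + n)) ∣8+t-o∣≡8+δ ⟩
    arc (8 + n) (8 + δ)        ≡⟨ arc-long (+-monoʳ-≤ 8 (≤-trans n≤δ+δ (+-monoʳ-≤ δ (m≤n+m δ 8)))) ⟩
    n ∸ δ                      ≡⟨ arc-long n≤δ+δ ⟨
    arc n δ                    ≡⟨ cong (arc n) (m≤n⇒∣n-m∣≡n∸m o≤t) ⟨
    arc n ∣ t - o ∣            ∎
    where open ≡-Reasoning

profile-stretch : ∀ {n t} → 22 ≤ n → t < 8 + n →
  Σ[ t′ ∈ ℕ ] Σ[ c ∈ ℕ ] t′ < n × (∀ i → profile (8 + n) t i ≡ c + profile n t′ i)
profile-stretch {n} {t} 22≤n t<8+n with t ≤? 10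
... | yes t≤10 = t , 0 , ≤-<-trans t≤10 (≤-trans (m≤m+n 11 11) 22≤n) , profile-near 22≤n t≤10
... | no t≰10 with m≤n⇒∃[o]m+o≡n (≤-trans (m≤m+n 4 7) (≰⇒> t≰10))
...   | t′ , refl with t′ <? n
...     | yes t′<n = t′ , 1 , t′<n , profile-middle (+-cancelˡ-≤ 4 7 t′ (≰⇒> t≰10)) (<⇒≤ t′<n)
...     | no t′≮n with m≤n⇒∃[o]m+o≡n (≤-trans (m≤m+n 4 18) (≤-trans 22≤n (≮⇒≥ t′≮n)))
...       | t″ , refl = t″ , 0 , +-cancelˡ-< 8 t″ n t<8+n , profile-behind 22≤n (≮⇒≥ t′≮n)

allConfusable-stretch : ∀ {n} → 22 ≤ n → AllConfusable n → AllConfusable (8 + n)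
allConfusable-stretch 22≤n confusable t₁<8+n t₂<8+n
  with profile-stretch 22≤n t₁<8+n | profile-stretch 22≤n t₂<8+n
... | t₁′ , c₁ , t₁′<n , stretch₁ | t₂′ , c₂ , t₂′<n , stretch₂
  with confusable t₁′<n t₂′<n
... | i , j , oi<oj , agree₁ , agree₂ = i , j , oi<oj , transfer stretch₁ agree₁ , transfer stretch₂ agree₂
  where
  transfer : ∀ {p q : Fin 6 → ℕ} {c} → (∀ k → p k ≡ c + q k) → q i ≡ q j → p i ≡ p j
  transfer {c = c} stretch agree = trans (stretch i) (trans (cong (c +_) agree) (sym (stretch j)))

allConfusable : ∀ k r → 1 ≤ k → r ≡ 2 ⊎ r ≡ 5 → AllConfusable (8 * k + r)
allConfusable 1 _ _ (inj₁ refl) = allConfusable-by-computation 10 _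
allConfusable 1 _ _ (inj₂ refl) = allConfusable-by-computation 13 _
allConfusable 2 _ _ (inj₁ refl) = allConfusable-by-computation 18 _
allConfusable 2 _ _ (inj₂ refl) = allConfusable-by-computation 21 _
allConfusable 3 _ _ (inj₁ refl) = allConfusable-by-computation 26 _
allConfusable 3 _ _ (inj₂ refl) = allConfusable-by-computation 29 _
allConfusable (suc k@(suc (suc (suc _)))) r _ r∈ =
  subst AllConfusable (8+[8k+r]≡8[1+k]+r k r) (allConfusable-stretch 22≤8k+r (allConfusable k r (s≤s z≤n) r∈))
  where
  22≤8k+r : 22 ≤ 8 * k + r
  22≤8k+r = ≤-trans (m≤m+n 22 2) (≤-trans (*-monoʳ-≤ 8 (s≤s (s≤s (s≤s z≤n)))) (m≤m+n (8 * k) r))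
  8+[8k+r]≡8[1+k]+r : ∀ k r → 8 + (8 * k + r) ≡ 8 * suc k + r
  8+[8k+r]≡8[1+k]+r = solve-∀

enumerate : ∀ {k} (X : Subset k) → Σ[ xs ∈ List (Fin k) ] length xs ≡ ∣ X ∣ × (∀ {x} → x ∈ X → x ∈ₗ xs)
enumerate [] = [] , refl , λ ()
enumerate (inside ∷ X) with enumerate X
... | xs , len , complete = Fin.zero ∷ map Fin.suc xs , cong suc (trans (length-map Fin.suc xs) len) , complete′
  where
  complete′ : ∀ {x} → x ∈ inside ∷ X → x ∈ₗ Fin.zero ∷ map Fin.suc xs
  complete′ here        = here refl
  complete′ (there x∈X) = there (∈-map⁺ Fin.suc (complete x∈X))
enumerate (outside ∷ X) with enumerate X
... | xs , len , complete = map Fin.suc xs , trans (length-map Fin.suc xs) len , complete′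
  where
  complete′ : ∀ {x} → x ∈ outside ∷ X → x ∈ₗ map Fin.suc xs
  complete′ (there x∈X) = ∈-map⁺ Fin.suc (complete x∈X)

covered-by-two : ∀ {k} (default : Fin k) (X : Subset k) → ∣ X ∣ ≤ 2 →
  Σ[ x₁ ∈ Fin k ] Σ[ x₂ ∈ Fin k ] (∀ {x} → x ∈ X → x ≡ x₁ ⊎ x ≡ x₂)
covered-by-two {k} default X ∣X∣≤2 with enumerate X
... | xs , len , complete = cover xs (subst (_≤ 2) (sym len) ∣X∣≤2) complete
  where
  cover : ∀ xs → length xs ≤ 2 → (∀ {x} → x ∈ X → x ∈ₗ xs) →
    Σ[ x₁ ∈ Fin k ] Σ[ x₂ ∈ Fin k ] (∀ {x} → x ∈ X → x ≡ x₁ ⊎ x ≡ x₂)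
  cover []             _ complete = default , default , λ x∈X → contradiction (complete x∈X) λ ()
  cover (x₁ ∷ [])      _ complete = x₁ , x₁ , λ x∈X → one-of (complete x∈X)
    where
    one-of : ∀ {x} → x ∈ₗ x₁ ∷ [] → x ≡ x₁ ⊎ x ≡ x₁
    one-of (here x≡x₁) = inj₁ x≡x₁
  cover (x₁ ∷ x₂ ∷ []) _ complete = x₁ , x₂ , λ x∈X → one-of (complete x∈X)
    where
    one-of : ∀ {x} → x ∈ₗ x₁ ∷ x₂ ∷ [] → x ≡ x₁ ⊎ x ≡ x₂
    one-of (here x≡x₁)         = inj₁ x≡x₁
    one-of (there (here x≡x₂)) = inj₂ x≡x₂
  cover (_ ∷ _ ∷ _ ∷ _) (s≤s (s≤s ())) _

module Landmarks (m : ℕ) (7≤m : 7 ≤ m) where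

  open Circulant m (≤-trans (m≤m+n 4 3) 7≤m) public

  offset<n : ∀ i → offset i < n
  offset<n i = s≤s (≤-trans (offset≤7 i) 7≤m)

  dist-profile : ∀ (a : Fin n) {t d} i → t < n → IsDist (a ⊕ offset i) (a ⊕ t) d → d ≡ profile n t i
  dist-profile a {t} i t<n = dist-apart (apart-offsets a (offset<n i) t<n) (arc+arc≤n ∣t-o∣≤n)
    where
    ∣t-o∣≤n : ∣ t - offset i ∣ ≤ n
    ∣t-o∣≤n = ≤-trans (∣m-n∣≤m⊔n t (offset i)) (⊔-lub (<⇒≤ t<n) (<⇒≤ (offset<n i)))

  ⊕-surjective : ∀ (a x : Fin n) → Σ[ t ∈ ℕ ] t < n × a ⊕ t ≡ x
  ⊕-surjective a x with toℕ a ≤? toℕ x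
  ... | yes a≤x = toℕ x ∸ toℕ a , ≤-<-trans (m∸n≤m (toℕ x) (toℕ a)) (toℕ<n x) ,
                  ⊕-≡ a _ 0 (trans (m+[n∸m]≡n a≤x) (sym (+-identityʳ (toℕ x))))
  ... | no a≰x = toℕ x + n ∸ toℕ a , m<n+o⇒m∸n<o (toℕ x + n) (toℕ a) (+-monoˡ-< n (≰⇒> a≰x)) ,
                 ⊕-≡ a _ 1 (trans (m+[n∸m]≡n a≤x+n) (cong (toℕ x +_) (sym (+-identityʳ n))))
    where
    a≤x+n : toℕ a ≤ toℕ x + n
    a≤x+n = ≤-trans (<⇒≤ (toℕ<n a)) (m≤n+m n (toℕ x))

  offsets-distinct : ∀ (a : Fin n) i j → offset i < offset j → a ⊕ offset i ≢ a ⊕ offset j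
  offsets-distinct a i j oi<oj a⊕oi≡a⊕oj =
    p≢p⊕c (a ⊕ offset i) (m<n⇒0<n∸m oi<oj) oj∸oi<n (trans a⊕oi≡a⊕oj (sym a⊕oi⊕δ≡a⊕oj))
    where
    oj∸oi<n : offset j ∸ offset i < n
    oj∸oi<n = ≤-<-trans (m∸n≤m (offset j) (offset i)) (offset<n j)
    a⊕oi⊕δ≡a⊕oj : (a ⊕ offset i) ⊕ (offset j ∸ offset i) ≡ a ⊕ offset j
    a⊕oi⊕δ≡a⊕oj = trans (⊕-assoc a (offset i) _) (cong (a ⊕_) (m+[n∸m]≡n (<⇒≤ oi<oj)))

  a⊕offset∈ : ∀ (a : Fin n) i → a ⊕ offset i ∈ₗ map (a ⊕_) offsets
  a⊕offset∈ a i = ∈-map⁺ (a ⊕_) (∈-lookup i)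

  two-landmarks-blind : AllConfusable n → (a x₁ x₂ : Fin n) →
    Σ[ i ∈ Fin 6 ] Σ[ j ∈ Fin 6 ] offset i < offset j ×
      (∀ {x d d′} → x ≡ x₁ ⊎ x ≡ x₂ → IsDist (a ⊕ offset i) x d → IsDist (a ⊕ offset j) x d′ → d ≡ d′)
  two-landmarks-blind confusable a x₁ x₂ with ⊕-surjective a x₁ | ⊕-surjective a x₂
  ... | t₁ , t₁<n , refl | t₂ , t₂<n , refl with confusable t₁<n t₂<n
  ... | i , j , oi<oj , agree₁ , agree₂ = i , j , oi<oj , blind
    where
    blind : ∀ {x d d′} → x ≡ a ⊕ t₁ ⊎ x ≡ a ⊕ t₂ → IsDist (a ⊕ offset i) x d → IsDist (a ⊕ offset j) x d′ → d ≡ d′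
    blind (inj₁ refl) dᵢ dⱼ = trans (dist-profile a i t₁<n dᵢ) (trans agree₁ (sym (dist-profile a j t₁<n dⱼ)))
    blind (inj₂ refl) dᵢ dⱼ = trans (dist-profile a i t₂<n dᵢ) (trans agree₂ (sym (dist-profile a j t₂<n dⱼ)))

  not-resolved-by-two : AllConfusable n → (a : Fin n) (X : Subset n) → ∣ X ∣ ≤ 2 → ¬ Resolves X (map (a ⊕_) offsets)
  not-resolved-by-two confusable a X ∣X∣≤2 resolves with covered-by-two a X ∣X∣≤2
  ... | x₁ , x₂ , covered with two-landmarks-blind confusable a x₁ x₂
  ... | i , j , oi<oj , blind with resolves _ _ (a⊕offset∈ a i) (a⊕offset∈ a j) (offsets-distinct a i j oi<oj)
  ... | x , x∈X , d , d′ , dᵢ , dⱼ , d≢d′ = d≢d′ (blind (covered x∈X) dᵢ dⱼ)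

lemma3p16 : (k r : ℕ) → k ≥ 1 → (r ≡ 2 ⊎ r ≡ 5) →
    (a : Fin (8 * k + r)) → (X : Subset (8 * k + r)) →
    Resolves X (a ∷ (a ⊕ 1) ∷ (a ⊕ 2) ∷ (a ⊕ 5) ∷ (a ⊕ 6) ∷ (a ⊕ 7) ∷ []) →
    ∣ X ∣ ≥ 3
lemma3p16 k@(suc k′) r k≥1 r∈ a X resolves with 3 ≤? ∣ X ∣
... | yes 3≤∣X∣ = 3≤∣X∣
... | no 3≰∣X∣  = ⊥-elim (not-resolved-by-two (allConfusable k r k≥1 r∈) a X (≤-pred (≰⇒> 3≰∣X∣))
                            (subst (Resolves X) A≡a⊕offsets resolves))
  where
  7≤m : 7 ≤ ℕ.pred (8 * k + r)
  7≤m = ≤-trans (*-monoʳ-≤ 7 (s≤s z≤n)) (≤-trans (m≤n+m (7 * k) k′) (m≤m+n _ r))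
  open Landmarks (ℕ.pred (8 * k + r)) 7≤m
  A≡a⊕offsets : a ∷ (a ⊕ 1) ∷ (a ⊕ 2) ∷ (a ⊕ 5) ∷ (a ⊕ 6) ∷ (a ⊕ 7) ∷ [] ≡ map (a ⊕_) offsets
  A≡a⊕offsets = cong (_∷ map (a ⊕_) (1 ∷ 2 ∷ 5 ∷ 6 ∷ 7 ∷ [])) (sym (⊕-identityʳ a))
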